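{- Let $k\geq 4$ and let $\mathbf{u}$, $\pi$ be as in the context. Let $u=u_1u_2\cdots u_n$ and $v=v_1v_2\cdots v_n$ be factors of $\mathbf{u}$ with $\pi(u)=\pi(v)$ and $u_\ell\neq v_\ell$ for every $\ell=1,\ldots,n$. Then $n\leq k+1$. If, moreover, both $u0$ and $v0$ are factors of $\mathbf{u}$, or both $u0'$ and $v0'$ are factors of $\mathbf{u}$, then $n\leq k-1$ and $\pi(u)=\pi(v)$ equals $1^n$ or $0^n$.
   Context: Fix an integer $k\geq 4$. Let $\mathcal{A}=\{0,1,\ldots,k-1,0',1',\ldots,(k-1)'\}$. Let $\xi:\mathcal{A}^*\to\mathcal{A}^*$ be the morphism given by $\xi(0)=01$, $\xi(j)=j+1$ for $1\leq j\leq k-2$, $\xi(k-1)=0'$, and $\xi(0')=0'1'$, $\xi(j')=(j+1)'$ for $1\leq j\leq k-2$, $\xi((k-1)')=0$. Let $\mathbf{u}=\xi^\omega(0)$ be the infinite fixed point of $\xi$ starting with $0$. Let $\pi:\mathcal{A}^*\to\{0,1\}^*$ be the letter-to-letter morphism with $\pi(0)=0$, $\pi(j')=0$ for $1\leq j\leq k-1$, $\pi(0')=1$, $\pi(j)=1$ for $1\leq j\leq k-1$. -}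

module Defs where

open import Data.Nat using (ℕ; zero; suc; _<?_)
open import Data.Fin using (Fin; zero; suc; toℕ; fromℕ<)
open import Data.Bool using (Bool; true; false; not)
open import Data.Product using (_×_; _,_; ∃; ∃-syntax)
open import Data.List using (List; []; _∷_; _++_; concatMap)
open import Relation.Nullary using (yes; no)
import Data.Empty
open import Relation.Binary.PropositionalEquality using (_≡_)

-- The alphabet A = {0,...,k-1,0',...,(k-1)'}:
-- (j , false) is the letter j, (j , true) is the primed letter j'.
Letter : ℕ → Set
Letter k = Fin k × Bool

next : ∀ {k} → Letter k → Letter k
next {suc k} (j , b) with suc (toℕ j) <? suc k
... | yes p = (fromℕ< p , b)
... | no _  = (zero , not b)

-- The morphism ξ on letters:
-- ξ(0)=01, ξ(j)=j+1 (1≤j≤k-2), ξ(k-1)=0', and symmetrically for primed letters.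
ξ : ∀ {k} → Letter k → List (Letter k)
ξ (zero , b)  = (zero , b) ∷ next (zero , b) ∷ []
ξ (suc j , b) = next (suc j , b) ∷ []

ξ* : ∀ {k} → List (Letter k) → List (Letter k)
ξ* = concatMap ξ

iter : ∀ {k} → ℕ → List (Letter k) → List (Letter k)
iter zero    w = w
iter (suc m) w = ξ* (iter m w)

-- ξ^m(0); these are exactly the finite prefixes of the fixed point u = ξ^ω(0)
-- (they form a chain of prefixes since ξ(0) starts with 0).
uPrefix : ∀ k → ℕ → List (Letter k)
uPrefix zero    m = []
uPrefix (suc k) m = iter m ((zero , false) ∷ [])

Factor : ∀ {k} → List (Letter k) → Set
Factor {k} w = ∃[ m ] ∃[ p ] ∃[ s ] (uPrefix k m ≡ p ++ w ++ s)

-- The letter-to-letter projection π : A → {0,1}, with false = 0 and true = 1.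
π : ∀ {k} → Letter k → Bool
π (zero  , false) = false
π (suc _ , false) = true
π (zero  , true)  = true
π (suc _ , true)  = false

-- FactorAppend b w : the word w followed by the letter 0 (b = false) or 0' (b = true)
-- is a factor of u.  (For k = 0 the alphabet is empty; this case never arises since k ≥ 4.)
FactorAppend : ∀ {k} → Bool → List (Letter k) → Set
FactorAppend {zero}  b w = Data.Empty.⊥
FactorAppend {suc k} b w = Factor (w ++ (zero , b) ∷ [])

module Submission where

-- Cut u into runs ξ^L(0) = 0 1 ⋯ L and ξ^L(0') = 0' 1' ⋯ L' with 1 ≤ L ≤ k, where the letter at
-- position k of a run is the 0 or 0' of the other kind.  On the first letter of a run π takes one
-- value and on the others the opposite one, so two letterwise different factors with equal
-- π-images sit at different positions of their runs, which advance in step until one factor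
-- starts a new run; then the other one must start a run at the next letter.  A run of two letters
-- only follows a full run, so this alternation stops after three letters, and n ≤ k + 1 follows.
-- If both factors are followed by 0 or 0', neither of them contains a run start, so each lies
-- inside one run: π is constant on it, and of the two distinct starting positions one is at least
-- 2, whence n ≤ k − 1.

open import Defs
open import Data.Nat using (ℕ; zero; suc; _≤_; _<_; _+_; _∸_; _⊓_; z≤n; s≤s; z<s; _<?_)
open import Data.Nat.Properties
  using (≤-refl; ≤-trans; ≤-antisym; ≤-reflexive; ≤-pred; n≤1+n; ≮⇒≥; ≤∧≢⇒<; <-irrefl;
         n≢0⇒n>0; n>0⇒n≢0; +-suc; +-comm; m<m+n; m+n≤o⇒m≤o; +-monoˡ-≤; +-monoʳ-≤;
         ⊓-glb; m⊓n≤m; m⊓n≤n; m≤n⇒m⊓n≡m; m≥n⇒m⊓n≡n; module ≤-Reasoning)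
open import Data.Bool using (Bool; true; false; not)
open import Data.Bool.Properties using (not-¬; not-injective)
open import Data.Fin using (zero; suc; toℕ; fromℕ<)
open import Data.Fin.Properties using (toℕ-fromℕ<)
open import Data.Product using (_×_; _,_; ∃-syntax)
open import Data.Sum using (_⊎_; inj₁; inj₂)
open import Data.List using (List; []; _∷_; _++_; [_]; map; length; replicate; concatMap)
open import Data.List.Properties using (length-map; map-concatMap; concatMap-cong; concatMap-map; ∷-injective)
open import Data.List.Relation.Unary.All as All using (All; []; _∷_)
import Data.List.Relation.Unary.All.Properties as Allₚ
open import Data.List.Relation.Unary.Linked as Linked using (Linked; []; [-]; _∷_)
open import Data.List.Relation.Binary.Pointwise as Pointwise using (Pointwise; []; _∷_; Pointwise-length)
open import Data.Empty using (⊥-elim)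
open import Function using (_on_; _∘′_)
open import Relation.Binary.PropositionalEquality
  using (_≡_; _≢_; refl; sym; trans; cong; cong₂; subst; subst₂; module ≡-Reasoning)
open import Relation.Nullary using (yes; no; ¬_)

private variable
  A B : Set

map-++⁻ : ∀ (f : A → B) xs {ys zs} → map f xs ≡ ys ++ zs →
          ∃[ xs₁ ] ∃[ xs₂ ] xs ≡ xs₁ ++ xs₂ × map f xs₁ ≡ ys × map f xs₂ ≡ zs
map-++⁻ f xs       {[]}     refl = [] , xs , refl , refl , refl
map-++⁻ f (x ∷ xs) {y ∷ ys} eq with refl , eq′ ← ∷-injective eq
  with xs₁ , xs₂ , refl , refl , refl ← map-++⁻ f xs {ys} eq′ = x ∷ xs₁ , xs₂ , refl , refl , refl

map-∷ʳ⁻ : ∀ (f : A → B) xs {ys y} → map f xs ≡ ys ++ [ y ] →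
          ∃[ xs′ ] ∃[ x ] xs ≡ xs′ ++ [ x ] × map f xs′ ≡ ys × f x ≡ y
map-∷ʳ⁻ f xs {ys} eq with map-++⁻ f xs {ys} eq
... | xs′ , x ∷ [] , refl , refl , refl = xs′ , x , refl , refl , refl

module _ {R : A → A → Set} where

  Linked-++⁻ˡ : ∀ xs {ys} → Linked R (xs ++ ys) → Linked R xs
  Linked-++⁻ˡ []           _       = []
  Linked-++⁻ˡ (x ∷ [])     _       = [-]
  Linked-++⁻ˡ (x ∷ y ∷ xs) (r ∷ l) = r ∷ Linked-++⁻ˡ (y ∷ xs) l

  Linked-++⁻ʳ : ∀ xs {ys} → Linked R (xs ++ ys) → Linked R ys
  Linked-++⁻ʳ []       l = l
  Linked-++⁻ʳ (x ∷ xs) l = Linked-++⁻ʳ xs (Linked.tail l)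

replicate-true⊎false : ∀ {n} {bs : List Bool} b →
                       bs ≡ replicate n b → bs ≡ replicate n true ⊎ bs ≡ replicate n false
replicate-true⊎false true  = inj₁
replicate-true⊎false false = inj₂

Twin : ∀ {k} → Letter k → Letter k → Set
Twin a b = a ≢ b × π a ≡ π b

twin-sym : ∀ {k} {a b : Letter k} → Twin a b → Twin b a
twin-sym (a≢b , πa≡πb) = a≢b ∘′ sym , sym πa≡πb

pointwise-twin : ∀ {k} {u v : List (Letter k)} → Pointwise _≢_ u v → map π u ≡ map π v → Pointwise Twin u v
pointwise-twin []          _  = []
pointwise-twin (a≢b ∷ u≢v) eq with πa≡πb , eq′ ← ∷-injective eq = (a≢b , πa≡πb) ∷ pointwise-twin u≢v eq′

module Runs (m : ℕ) where

  k : ℕ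
  k = 2 + m

  -- Position k of a run of kind b is the letter 0 of the other kind, which ends a full run;
  -- larger positions never occur in valid states.
  letter : Bool → ℕ → Letter k
  letter b p with p <? k
  ... | yes p<k = fromℕ< p<k , b
  ... | no _    = zero , not b

  -- state b p L stands for the letter at position p of the run letter b 0 ⋯ letter b L.
  record State : Set where
    constructor state
    field
      kind : Bool
      pos  : ℕ
      len  : ℕ
  open State

  letterOf : State → Letter k
  letterOf (state b p _) = letter b p

  record Valid (s : State) : Set where
    constructor valid
    field
      1≤len   : 1 ≤ len s
      pos≤len : pos s ≤ len s
      len≤k   : len s ≤ k

  -- A run of two letters (M = 1) only follows a full run (L = k).
  data Step : State → State → Set where
    inside : ∀ {b p L} → p < L → Step (state b p L) (state b (suc p) L)
    newrun : ∀ {b p L c M} → p ≡ L → (M ≡ 1 → L ≡ k) → Step (state b p L) (state c 0 M)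

  Path : List State → Set
  Path σ = All Valid σ × Linked Step σ

  _≍_ : State → State → Set
  _≍_ = Twin on letterOf

  twins-sym : ∀ {σ τ} → Pointwise _≍_ σ τ → Pointwise _≍_ τ σ
  twins-sym = Pointwise.symmetric twin-sym

  private variable
    b c : Bool
    L : ℕ
    s s′ s″ s₊ t t′ t″ t‴ t₊ : State
    σ τ : List State

  next≡letter : ∀ j b → next (j , b) ≡ letter b (suc (toℕ j))
  next≡letter j b with suc (toℕ j) <? k
  ... | yes _ = refl
  ... | no _  = refl

  letter-k : ∀ b → letter b k ≡ letter (not b) 0
  letter-k b with k <? k
  ... | yes k<k = ⊥-elim (<-irrefl refl k<k)
  ... | no _    = refl

  π-letter-0 : ∀ b → π (letter b 0) ≡ b
  π-letter-0 false = refl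
  π-letter-0 true  = refl

  π-letter-suc : ∀ b p → π (letter b (suc p)) ≡ not b
  π-letter-suc b p with suc p <? k
  π-letter-suc false p | yes _ = refl
  π-letter-suc true  p | yes _ = refl
  π-letter-suc false p | no _  = refl
  π-letter-suc true  p | no _  = refl

  π-letter-injective : ∀ p → π (letter b p) ≡ π (letter c p) → b ≡ c
  π-letter-injective {b} {c} zero    eq = trans (sym (π-letter-0 b)) (trans eq (π-letter-0 c))
  π-letter-injective {b} {c} (suc p) eq =
    not-injective (trans (sym (π-letter-suc b p)) (trans eq (π-letter-suc c p)))

  ¬twin-same-position : ∀ p → ¬ Twin (letter b p) (letter c p)
  ¬twin-same-position p (≢ , eq) = ≢ (cong (λ b → letter b p) (π-letter-injective p eq))

  path-++⁻ˡ : ∀ σ {ρ} → Path (σ ++ ρ) → Path σ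
  path-++⁻ˡ σ (v , l) = Allₚ.++⁻ˡ σ v , Linked-++⁻ˡ σ l

  path-++⁻ʳ : ∀ σ {ρ} → Path (σ ++ ρ) → Path ρ
  path-++⁻ʳ σ (v , l) = Allₚ.++⁻ʳ σ v , Linked-++⁻ʳ σ l

  grow : ℕ → ℕ
  grow L = suc L ⊓ k

  -- ξ lengthens a run by one letter, except that a full run keeps its length
  -- and its last letter, 0 of the other kind, becomes a new run of two letters.
  ξ̂ : State → List State
  ξ̂ (state b zero L) = state b 0 (grow L) ∷ state b 1 (grow L) ∷ []
  ξ̂ (state b (suc p) L) with suc p <? k
  ... | yes _ = state b (suc (suc p)) (grow L) ∷ []
  ... | no _  = state (not b) 0 1 ∷ state (not b) 1 1 ∷ []

  letterOf-ξ̂ : ∀ s → map letterOf (ξ̂ s) ≡ ξ (letterOf s)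
  letterOf-ξ̂ (state b zero L) = refl
  letterOf-ξ̂ (state b (suc p) L) with suc p <? k
  ... | yes p<k = cong [_] (sym (trans (next≡letter _ b) (cong (letter b ∘′ suc) (toℕ-fromℕ< p<k))))
  ... | no _    = refl

  letterOf-ξ̂* : ∀ σ → map letterOf (concatMap ξ̂ σ) ≡ ξ* (map letterOf σ)
  letterOf-ξ̂* σ = begin
    map letterOf (concatMap ξ̂ σ)     ≡⟨ map-concatMap letterOf ξ̂ σ ⟩
    concatMap (map letterOf ∘′ ξ̂) σ  ≡⟨ concatMap-cong letterOf-ξ̂ σ ⟩
    concatMap (ξ ∘′ letterOf) σ       ≡⟨ concatMap-map ξ letterOf σ ⟨
    ξ* (map letterOf σ)               ∎
    where open ≡-Reasoning

  ξ̂-valid : Valid s → All Valid (ξ̂ s)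
  ξ̂-valid {state b zero L} _ = valid z<s z≤n (m⊓n≤n _ k) ∷ valid z<s z<s (m⊓n≤n _ k) ∷ []
  ξ̂-valid {state b (suc p) L} (valid _ p<L _) with suc p <? k
  ... | yes p<k = valid z<s (⊓-glb (s≤s p<L) p<k) (m⊓n≤n _ k) ∷ []
  ... | no _    = valid z<s z≤n (s≤s z≤n) ∷ valid z<s ≤-refl (s≤s z≤n) ∷ []

  ξ̂-linked : Valid s → Linked Step (ξ̂ s ++ [])
  ξ̂-linked {state b zero L} _ = inside z<s ∷ [-]
  ξ̂-linked {state b (suc p) L} _ with suc p <? k
  ... | yes _ = [-]
  ... | no _  = inside z<s ∷ [-]

  ξ̂-step : ∀ {ρ} → Valid s → Valid s′ → Step s s′ → Linked Step (ξ̂ s′ ++ ρ) → Linked Step (ξ̂ s ++ ξ̂ s′ ++ ρ)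
  ξ̂-step _ _ (inside {p = zero} {L = suc L} _) l = inside z<s ∷ inside (s≤s (s≤s z≤n)) ∷ l
  ξ̂-step {state b (suc p) L} (valid _ _ L≤k) _ (inside p<L) l with suc p <? k | suc (suc p) <? k
  ... | yes _   | yes p<k = inside (⊓-glb (s≤s p<L) p<k) ∷ l
  ... | yes p<k | no p≮k  = newrun (trans p≡k (sym grow≡k)) (λ _ → grow≡k) ∷ l
    where
    p≡k : suc (suc p) ≡ k
    p≡k = ≤-antisym p<k (≮⇒≥ p≮k)
    grow≡k : grow L ≡ k
    grow≡k = m≥n⇒m⊓n≡n (≤-trans (≮⇒≥ p≮k) (≤-trans p<L (n≤1+n L)))
  ... | no p≮k  | _       = ⊥-elim (p≮k (≤-trans p<L L≤k))
  ξ̂-step {state b zero L} (valid () _ _) _ (newrun refl _) l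
  ξ̂-step {state b (suc p) L} {state c zero zero} _ (valid () _ _) (newrun refl _) l
  ξ̂-step {state b (suc p) L} {state c zero (suc M)} _ _ (newrun refl _) l with suc p <? k
  ... | yes p<k = newrun (sym (m≤n⇒m⊓n≡m p<k)) (λ ()) ∷ l
  ... | no _    = inside z<s ∷ newrun refl (λ ()) ∷ l

  ξ̂*-linked : All Valid σ → Linked Step σ → Linked Step (concatMap ξ̂ σ)
  ξ̂*-linked []                [] = []
  ξ̂*-linked (v ∷ [])          [-] = ξ̂-linked v
  ξ̂*-linked (v ∷ vs@(v′ ∷ _)) (st ∷ l) = ξ̂-step v v′ st (ξ̂*-linked vs l)

  ξ̂*-path : Path σ → Path (concatMap ξ̂ σ)
  ξ̂*-path (v , l) = Allₚ.concat⁺ (Allₚ.gmap⁺ ξ̂-valid v) , ξ̂*-linked v l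

  prefix-path : ∀ i → ∃[ σ ] Path σ × map letterOf σ ≡ uPrefix k i
  prefix-path zero    = [ state false 0 1 ] , (valid z<s z≤n (s≤s z≤n) ∷ [] , [-]) , refl
  prefix-path (suc i) with σ , path , eq ← prefix-path i =
    concatMap ξ̂ σ , ξ̂*-path path , trans (letterOf-ξ̂* σ) (cong ξ* eq)

  factor-path : ∀ {w} → Factor w → ∃[ σ ] Path σ × map letterOf σ ≡ w
  factor-path {w} (i , p , _ , eq) with σ , path , eqσ ← prefix-path i
    with σ₁ , σ₂₃ , refl , _ , eq₂₃ ← map-++⁻ letterOf σ {p} (trans eqσ eq)
    with σ₂ , _ , refl , eq₂ , _ ← map-++⁻ letterOf σ₂₃ {w} eq₂₃ =
    σ₂ , path-++⁻ˡ σ₂ (path-++⁻ʳ σ₁ path) , eq₂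

  factor-path-∷ʳ : ∀ {w a} → Factor (w ++ [ a ]) →
                   ∃[ σ ] ∃[ s₊ ] Path (σ ++ [ s₊ ]) × map letterOf σ ≡ w × letterOf s₊ ≡ a
  factor-path-∷ʳ f with σ′ , path , eq ← factor-path f
    with σ , s₊ , refl , eqσ , eq₊ ← map-∷ʳ⁻ letterOf σ′ eq = σ , s₊ , path , eqσ , eq₊

  pos≤k : Valid s → pos s ≤ k
  pos≤k (valid _ p≤L L≤k) = ≤-trans p≤L L≤k

  step-from-0 : Valid (state b 0 L) → Step (state b 0 L) s′ → s′ ≡ state b 1 L
  step-from-0 _              (inside _)      = refl
  step-from-0 (valid () _ _) (newrun refl _)

  letterOf≡0⇒pos≢1 : letterOf s ≡ (zero , c) → pos s ≢ 1
  letterOf≡0⇒pos≢1 {state _ _ _} () refl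

  twin⇒pos≢ : s ≍ t → pos s ≢ pos t
  twin⇒pos≢ {state _ p _} {state _ _ _} tw refl = ¬twin-same-position p tw

  twin-start⇒pos≢k : s ≍ t → pos s ≡ 0 → pos t ≢ k
  twin-start⇒pos≢k {state b _ _} {state c _ _} tw refl refl =
    ¬twin-same-position 0 (subst (Twin (letter b 0)) (letter-k c) tw)

  start-flips-π : Valid s → Step s s′ → pos s ≡ 0 → π (letterOf s′) ≡ not (π (letterOf s))
  start-flips-π {state b _ _} v st refl with refl ← step-from-0 v st =
    trans (π-letter-suc b 0) (cong not (sym (π-letter-0 b)))

  -- Leaving a run start flips π, moving on inside a run does not.
  start-forces-start : Valid s → Step s s′ → Step t t′ → s ≍ t → s′ ≍ t′ → pos s ≡ 0 → pos t′ ≡ 0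
  start-forces-start _ _ (newrun _ _) _ _ _ = refl
  start-forces-start {s} {t = t@(state _ zero _)} _ _ (inside _) tw _ s₀ = ⊥-elim (twin⇒pos≢ {s} {t} tw s₀)
  start-forces-start {s} {s′} {state c (suc q) _} v st (inside _) (_ , πs≡πt) (_ , πs′≡πt′) s₀ =
    ⊥-elim (not-¬ refl (begin
      π (letterOf s)             ≡⟨ πs≡πt ⟩
      π (letter c (suc q))       ≡⟨ π-letter-suc c q ⟩
      not c                      ≡⟨ π-letter-suc c (suc q) ⟨
      π (letter c (suc (suc q))) ≡⟨ πs′≡πt′ ⟨
      π (letterOf s′)            ≡⟨ start-flips-π v st s₀ ⟩
      not (π (letterOf s))       ∎))
    where open ≡-Reasoning

  short-run-after-full : Step t t′ → Step t′ t″ → Step t″ t‴ → Valid t′ → pos t′ ≡ 0 → pos t‴ ≡ 0 → pos t ≡ k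
  short-run-after-full (newrun p≡L full) (inside _) (newrun 1≡M _) _ _ _ = trans p≡L (full (sym 1≡M))
  short-run-after-full (newrun _ _) (newrun refl _) _ (valid () _ _) _ _
  short-run-after-full (newrun _ _) (inside _) (inside _) _ _ ()
  short-run-after-full (inside _) _ _ _ () _

  twin-paths-short : Path (s ∷ σ) → Path (t ∷ τ) → Pointwise _≍_ (s ∷ σ) (t ∷ τ) → pos s ≡ 0 → length σ ≤ 2
  twin-paths-short {σ = []}         _ _ _ _ = z≤n
  twin-paths-short {σ = _ ∷ []}     _ _ _ _ = s≤s z≤n
  twin-paths-short {σ = _ ∷ _ ∷ []} _ _ _ _ = s≤s (s≤s z≤n)
  twin-paths-short {s} {_ ∷ s″ ∷ _ ∷ _} {t} {t′ ∷ _ ∷ t‴ ∷ _}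
    (v ∷ _ ∷ v″ ∷ _ , s→ ∷ s′→ ∷ s″→ ∷ _) (_ ∷ w′ ∷ _ , t→ ∷ t′→ ∷ t″→ ∷ _) (tw ∷ tw′ ∷ tw″ ∷ tw‴ ∷ _) s₀ =
    ⊥-elim (twin-start⇒pos≢k {s} {t} tw s₀ (short-run-after-full t→ t′→ t″→ w′ t′₀ t‴₀))
    where
    t′₀ : pos t′ ≡ 0
    t′₀ = start-forces-start v s→ t→ tw tw′ s₀
    s″₀ : pos s″ ≡ 0
    s″₀ = start-forces-start w′ t′→ s′→ (twin-sym tw′) (twin-sym tw″) t′₀
    t‴₀ : pos t‴ ≡ 0
    t‴₀ = start-forces-start v″ s″→ t″→ tw″ tw‴ s″₀

  twin-paths-after-start : Path (s ∷ σ) → Path (t ∷ τ) → Pointwise _≍_ (s ∷ σ) (t ∷ τ) → pos s ≡ 0 →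
                           length σ + pos t ≤ suc k
  twin-paths-after-start {s} {σ} {t} ps pt@(w ∷ _ , _) tws@(tw ∷ _) s₀ = begin
    length σ + pos t ≤⟨ +-monoˡ-≤ (pos t) (twin-paths-short {s} {σ} {t} ps pt tws s₀) ⟩
    2 + pos t        ≤⟨ s≤s (≤∧≢⇒< (pos≤k w) (twin-start⇒pos≢k {s} {t} tw s₀)) ⟩
    suc k            ∎
    where open ≤-Reasoning

  twin-paths-bound : Path (s ∷ σ) → Path (t ∷ τ) → Pointwise _≍_ (s ∷ σ) (t ∷ τ) →
                     length σ + pos s ⊓ pos t ≤ suc k
  twin-paths-bound {σ = []} (v ∷ _ , _) _ _ = ≤-trans (m⊓n≤m _ _) (≤-trans (pos≤k v) (n≤1+n k))
  twin-paths-bound {σ = _ ∷ σ} (_ ∷ vs , inside _ ∷ l) (_ ∷ ws , inside _ ∷ l′) (_ ∷ tws) =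
    subst (_≤ suc k) (+-suc (length σ) _) (twin-paths-bound (vs , l) (ws , l′) tws)
  twin-paths-bound {σ = s′ ∷ _} {τ = t′ ∷ _} (_ , newrun _ _ ∷ _) (_ , newrun _ _ ∷ _) (_ ∷ tw′ ∷ _) =
    ⊥-elim (twin⇒pos≢ {s′} {t′} tw′ refl)
  twin-paths-bound {state _ p _} {_ ∷ σ} {state _ q _}
    (_ ∷ vs , newrun _ _ ∷ l) (_ ∷ ws , inside _ ∷ l′) (_ ∷ tws) = begin
    suc (length σ) + p ⊓ q ≤⟨ +-monoʳ-≤ (suc (length σ)) (m⊓n≤n p q) ⟩
    suc (length σ) + q     ≡⟨ +-suc (length σ) q ⟨
    length σ + suc q       ≤⟨ twin-paths-after-start (vs , l) (ws , l′) tws refl ⟩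
    suc k                  ∎
    where open ≤-Reasoning
  twin-paths-bound {state _ p _} {_ ∷ σ} {state _ q _} {_ ∷ τ}
    (_ ∷ vs , inside _ ∷ l) (_ ∷ ws , newrun _ _ ∷ l′) (_ ∷ tws@(_ ∷ tws′)) = begin
    suc (length σ) + p ⊓ q ≤⟨ +-monoʳ-≤ (suc (length σ)) (m⊓n≤m p q) ⟩
    suc (length σ) + p     ≡⟨ +-suc (length σ) p ⟨
    length σ + suc p       ≡⟨ cong (_+ suc p) (Pointwise-length tws′) ⟩
    length τ + suc p       ≤⟨ twin-paths-after-start (ws , l′) (vs , l) (twins-sym tws) refl ⟩
    suc k                  ∎
    where open ≤-Reasoning

  twin-paths-length : Path σ → Path τ → Pointwise _≍_ σ τ → length σ ≤ suc k
  twin-paths-length {[]} _ _ _ = z≤n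
  twin-paths-length {s@(state _ zero _) ∷ _} {t@(state _ zero _) ∷ _} _ _ (tw ∷ _) =
    ⊥-elim (twin⇒pos≢ {s} {t} tw refl)
  twin-paths-length {state _ zero _ ∷ σ} {state _ (suc _) _ ∷ _} ps pt tws =
    ≤-trans (m<m+n (length σ) z<s) (twin-paths-after-start ps pt tws refl)
  twin-paths-length {state _ (suc _) _ ∷ _} {state _ zero _ ∷ τ} ps pt tws@(_ ∷ tws′) =
    ≤-trans (≤-reflexive (cong suc (Pointwise-length tws′)))
      (≤-trans (m<m+n (length τ) z<s) (twin-paths-after-start pt ps (twins-sym tws) refl))
  twin-paths-length {state _ (suc _) _ ∷ σ} {state _ (suc _) _ ∷ _} ps pt tws =
    ≤-trans (m<m+n (length σ) z<s) (twin-paths-bound ps pt tws)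

  Inner : State → Set
  Inner s = 0 < pos s

  inner-before-non-1 : Valid s → Step s s′ → pos s′ ≢ 1 → Inner s
  inner-before-non-1 {state _ zero _}    v st s′≢1 with refl ← step-from-0 v st = ⊥-elim (s′≢1 refl)
  inner-before-non-1 {state _ (suc _) _} _ _  _    = z<s

  inner-before-inner : Valid s → Step s s′ → Step t t′ → s ≍ t → s′ ≍ t′ → Inner t′ → Inner s
  inner-before-inner v st tt tw tw′ t′>0 =
    n≢0⇒n>0 (λ s₀ → n>0⇒n≢0 t′>0 (start-forces-start v st tt tw tw′ s₀))

  twin-paths-before-non-1-inner : Path (s ∷ σ ++ [ s₊ ]) → Path (t ∷ τ ++ [ t₊ ]) →
                                  Pointwise _≍_ (s ∷ σ) (t ∷ τ) → pos s₊ ≢ 1 → pos t₊ ≢ 1 →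
                                  All Inner (s ∷ σ) × All Inner (t ∷ τ)
  twin-paths-before-non-1-inner {σ = []} (v ∷ _ , st ∷ _) (w ∷ _ , tt ∷ _) (_ ∷ []) s₊≢1 t₊≢1 =
    inner-before-non-1 v st s₊≢1 ∷ [] , inner-before-non-1 w tt t₊≢1 ∷ []
  twin-paths-before-non-1-inner {σ = _ ∷ _}
    (v ∷ vs , st ∷ l) (w ∷ ws , tt ∷ l′) (tw ∷ tws@(tw′ ∷ _)) s₊≢1 t₊≢1
    with is@(i′ ∷ _) , it@(j′ ∷ _) ← twin-paths-before-non-1-inner (vs , l) (ws , l′) tws s₊≢1 t₊≢1 =
    inner-before-inner v st tt tw tw′ j′ ∷ is ,
    inner-before-inner w tt st (twin-sym tw) (twin-sym tw′) i′ ∷ it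

  inner-path-within-run : Path (s ∷ σ) → All Inner (s ∷ σ) →
                          length σ + pos s ≤ k ×
                          map π (map letterOf (s ∷ σ)) ≡ replicate (suc (length σ)) (not (kind s))
  inner-path-within-run {state _ zero _} _ (() ∷ _)
  inner-path-within-run {state b (suc p) _} {[]} (v ∷ [] , _) _ = pos≤k v , cong [_] (π-letter-suc b p)
  inner-path-within-run {state b (suc p) _} {_ ∷ σ} (_ ∷ vs , inside _ ∷ l) (_ ∷ is)
    with σ+p≤k , πσ ← inner-path-within-run (vs , l) is =
    subst (_≤ k) (+-suc (length σ) (suc p)) σ+p≤k , cong₂ _∷_ (π-letter-suc b p) πσ
  inner-path-within-run {state b (suc p) _} {_ ∷ σ} (_ ∷ _ , newrun _ _ ∷ _) (_ ∷ () ∷ _)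

  n+[2+p]≤k⇒n<k∸1 : ∀ n p → n + suc (suc p) ≤ k → n < k ∸ 1
  n+[2+p]≤k⇒n<k∸1 n p le =
    s≤s (m+n≤o⇒m≤o n (≤-pred (≤-pred (subst (_≤ k) (trans (+-suc n (suc p)) (cong suc (+-suc n p))) le))))

  distinct-inner-bound : ∀ {n p q} → p ≢ q → 0 < p → 0 < q → n + p ≤ k → n + q ≤ k → n < k ∸ 1
  distinct-inner-bound {p = 1}     {q = 1}               p≢q _ _ _     _     = ⊥-elim (p≢q refl)
  distinct-inner-bound {n} {suc (suc p)}                 _   _ _ n+p≤k _     = n+[2+p]≤k⇒n<k∸1 n p n+p≤k
  distinct-inner-bound {n} {1}     {q = suc (suc q)}     _   _ _ _     n+q≤k = n+[2+p]≤k⇒n<k∸1 n q n+q≤k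

  twin-paths-before-non-1 : Path (σ ++ [ s₊ ]) → Path (τ ++ [ t₊ ]) → Pointwise _≍_ σ τ →
                            pos s₊ ≢ 1 → pos t₊ ≢ 1 →
                            length σ ≤ k ∸ 1 × ∃[ b ] map π (map letterOf σ) ≡ replicate (length σ) b
  twin-paths-before-non-1 {[]} _ _ _ _ _ = z≤n , true , refl
  twin-paths-before-non-1 {s ∷ σ} {_} {t ∷ τ} ps pt tws@(tw ∷ tws′) s₊≢1 t₊≢1
    with inner-σ , inner-τ ← twin-paths-before-non-1-inner ps pt tws s₊≢1 t₊≢1
    with σ+ps≤k , πσ ← inner-path-within-run (path-++⁻ˡ (s ∷ σ) ps) inner-σ
    with τ+pt≤k , _  ← inner-path-within-run (path-++⁻ˡ (t ∷ τ) pt) inner-τ =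
    distinct-inner-bound (twin⇒pos≢ {s} {t} tw) (All.head inner-σ) (All.head inner-τ) σ+ps≤k
      (subst (λ n → n + pos t ≤ k) (sym (Pointwise-length tws′)) τ+pt≤k) ,
    not (kind s) , πσ

  twin-factors-length : ∀ {u v} → Factor u → Factor v → Pointwise Twin u v → length u ≤ k + 1
  twin-factors-length fu fv tws with σ , pσ , refl ← factor-path fu | τ , pτ , refl ← factor-path fv =
    subst₂ _≤_ (sym (length-map letterOf σ)) (+-comm 1 k)
      (twin-paths-length pσ pτ (Pointwise.map⁻ letterOf letterOf tws))

  twin-factors-before-0 : ∀ {u v} → Factor (u ++ [ zero , b ]) → Factor (v ++ [ zero , c ]) →
                          Pointwise Twin u v →
                          length u ≤ k ∸ 1 ×
                          (map π u ≡ replicate (length u) true ⊎ map π u ≡ replicate (length u) false)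
  twin-factors-before-0 fu fv tws
    with σ , s₊ , pσ , refl , s₊≡0 ← factor-path-∷ʳ fu | τ , t₊ , pτ , refl , t₊≡0 ← factor-path-∷ʳ fv
    rewrite length-map letterOf σ
    with len≤ , b , πσ ← twin-paths-before-non-1 pσ pτ (Pointwise.map⁻ letterOf letterOf tws)
                           (letterOf≡0⇒pos≢1 {s₊} s₊≡0) (letterOf≡0⇒pos≢1 {t₊} t₊≡0) =
    len≤ , replicate-true⊎false b πσ

lemma3 : (k : ℕ) → 4 ≤ k → (u v : List (Letter k)) →
    Factor u → Factor v → map π u ≡ map π v → Pointwise _≢_ u v →
    (length u ≤ k + 1) ×
    ((FactorAppend false u × FactorAppend false v) ⊎
     (FactorAppend true u × FactorAppend true v) →
      (length u ≤ k ∸ 1) ×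
      (map π u ≡ replicate (length u) true ⊎ map π u ≡ replicate (length u) false))
lemma3 (suc (suc m)) (s≤s (s≤s _)) u v fu fv πu≡πv u≢v =
  twin-factors-length fu fv tws ,
  λ { (inj₁ (fu0 , fv0)) → twin-factors-before-0 fu0 fv0 tws
    ; (inj₂ (fu0 , fv0)) → twin-factors-before-0 fu0 fv0 tws }
  where
  open Runs m
  tws : Pointwise Twin u v
  tws = pointwise-twin u≢v πu≡πv
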